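{- Let $S$ be a finite set of positive integers with largest element $k$, and suppose the smallest positive integer not in $S$ is $k-c$ for some integer $c>0$. Let $(a_n)_{n\ge1}$ be the $S$-LID sequence. Let $c'$ be a positive integer with $k\ge 2(c'+1)$. Then for all $n\ge1$, \[ a_n \ >\ \sum_{\substack{i\ge1\\ i(k-c')<n}} a_{n-i(k-c')} = a_{n-(k-c')}+a_{n-2(k-c')}+\cdots. \]
   Context: For a set $S$ of positive integers, the $S$-legal index difference ($S$-LID) sequence $(a_n)_{n\ge 1}$ is defined recursively: for each positive integer $n$, $a_n$ is the smallest positive integer that cannot be written as $\sum_{\ell\in L} a_\ell$ for some set $L \subseteq \{1,\dots,n-1\}$ such that $|i-j|\notin S$ for all $i,j\in L$ (the empty sum is $0$). -}

module Defs where

open import Data.Nat using (ℕ; zero; suc; _+_; _*_; _∸_; _≤_; _<_; _<?_; ∣_-_∣)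
open import Data.List using (List; map; filter; upTo)
open import Data.Nat.ListAction using (sum)
open import Data.List.Membership.Propositional using (_∈_; _∉_)
open import Data.List.Relation.Unary.All using (All)
open import Data.List.Relation.Unary.Unique.Propositional using (Unique)
open import Data.Product using (Σ; _×_)
open import Relation.Binary.PropositionalEquality using (_≡_)
open import Relation.Nullary using (¬_)

LegalIndexSet : List ℕ → ℕ → List ℕ → Set
LegalIndexSet S n L =
  Unique L
  × All (λ i → 1 ≤ i × i < n) L
  × (∀ {i j} → i ∈ L → j ∈ L → ∣ i - j ∣ ∉ S)

Representable : List ℕ → (ℕ → ℕ) → ℕ → ℕ → Set
Representable S a n m =
  Σ (List ℕ) λ L → LegalIndexSet S n L × sum (map a L) ≡ m

-- a is the S-LID sequence (indices n ≥ 1; the value at 0 is irrelevant):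
-- a n is the smallest positive integer not representable from a_1,…,a_{n-1}.
IsLID : List ℕ → (ℕ → ℕ) → Set
IsLID S a = ∀ n → 1 ≤ n →
  1 ≤ a n
  × ¬ Representable S a n (a n)
  × (∀ m → 1 ≤ m → m < a n → Representable S a n m)

strideSum : (ℕ → ℕ) → ℕ → ℕ → ℕ
strideSum a d n =
  sum (map (λ i → a (n ∸ suc i * d)) (filter (λ i → suc i * d <? n) (upTo n)))

{-# OPTIONS --safe #-}
module Submission where

-- The LID sequence is strictly increasing, and it is superadditive across gaps longer
-- than k: if p ≥ 1 and p + k ≤ j then a_j + a_p ≤ a_{j+1}, because j can be adjoined to
-- any legal index set below p.  With d = k - c′ the hypothesis k ≥ 2(c′ + 1) gives
-- d ≤ k ≤ 2d - 2, so two applications of superadditivity yield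
-- a_{p+d} + 2 a_p ≤ a_{p+2d}.  Writing n = p + 2d, the stride sum at n is
-- a_{p+d} + a_p + (stride sum at p), and the induction hypothesis bounds the last
-- term by a_p.

open import Defs
open import Data.Nat using (ℕ; zero; suc; _∸_; _*_; _+_; _≤_; _<_; _<?_; z≤n; s≤s; ∣_-_∣)
open import Data.Nat.Properties
open import Data.Nat.Tactic.RingSolver using (solve-∀)
open import Data.Nat.ListAction using (sum)
open import Data.List using (List; []; _∷_; map; filter; upTo)
open import Data.List.Properties using (map-upTo; map-∘; map-cong; filter-accept; filter-none; filter-≐)
open import Data.List.Membership.Propositional using (_∈_; _∉_)
open import Data.List.Relation.Unary.All using (All; []; _∷_)
import Data.List.Relation.Unary.All as All
open import Data.List.Relation.Unary.Any using (here; there)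
open import Data.List.Relation.Unary.AllPairs using ([]; _∷_)
open import Data.Bool using (true; false)
open import Data.Product using (_,_; _×_; proj₁; proj₂)
open import Data.Sum using (inj₁; inj₂)
open import Function using (_∘_)
open import Relation.Binary.PropositionalEquality
open import Relation.Nullary using (yes; no; does; contradiction)
open import Relation.Unary using (Pred; Decidable)

filter-map : ∀ {a b p} {A : Set a} {B : Set b} {P : Pred B p} (P? : Decidable P) (f : A → B) xs →
             filter P? (map f xs) ≡ map f (filter (P? ∘ f) xs)
filter-map P? f []       = refl
filter-map P? f (x ∷ xs) with does (P? (f x))
... | true  = cong (f x ∷_) (filter-map P? f xs)
... | false = filter-map P? f xs

module _ (a : ℕ → ℕ) (d : ℕ) where

  strideTerm : ℕ → ℕ → ℕ
  strideTerm n i = a (n ∸ suc i * d)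

  inStride? : (n : ℕ) → Decidable (λ i → suc i * d < n)
  inStride? n i = suc i * d <? n

  -- strideSum a d n is definitionally strideSumUpTo n n; freeing the range bound N lets
  -- the stride recursion below be structural in N.
  strideSumUpTo : ℕ → ℕ → ℕ
  strideSumUpTo N n = sum (map (strideTerm n) (filter (inStride? n) (upTo N)))

  strideSumUpTo-≤ : ∀ N {n} → n ≤ d → strideSumUpTo N n ≡ 0
  strideSumUpTo-≤ N {n} n≤d =
    cong (sum ∘ map (strideTerm n))
      (filter-none (inStride? n)
        (All.universal (λ i → ≤⇒≯ (≤-trans n≤d (m≤m+n d (i * d)))) (upTo N)))

  strideSumUpTo-suc : ∀ N {m} → 0 < m → strideSumUpTo (suc N) (d + m) ≡ a m + strideSumUpTo N m
  strideSumUpTo-suc N {m} 0<m = begin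
    strideSumUpTo (suc N) (d + m)
      ≡⟨ cong (λ xs → sum (map (strideTerm (d + m)) (filter (inStride? (d + m)) (0 ∷ xs))))
              (sym (map-upTo suc N)) ⟩
    sum (map (strideTerm (d + m)) (filter (inStride? (d + m)) (0 ∷ map suc (upTo N))))
      ≡⟨ cong (sum ∘ map (strideTerm (d + m))) (filter-accept (inStride? (d + m)) (+-monoʳ-< d 0<m)) ⟩
    strideTerm (d + m) 0
      + sum (map (strideTerm (d + m)) (filter (inStride? (d + m)) (map suc (upTo N))))
      ≡⟨ cong₂ _+_ (cong a ([m+n]∸[m+o]≡n∸o d m 0)) shifted ⟩
    a m + strideSumUpTo N m ∎
    where
      open ≡-Reasoning
      shifted : sum (map (strideTerm (d + m)) (filter (inStride? (d + m)) (map suc (upTo N))))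
              ≡ strideSumUpTo N m
      shifted = begin
        sum (map (strideTerm (d + m)) (filter (inStride? (d + m)) (map suc (upTo N))))
          ≡⟨ cong (sum ∘ map (strideTerm (d + m))) (filter-map (inStride? (d + m)) suc (upTo N)) ⟩
        sum (map (strideTerm (d + m)) (map suc (filter (inStride? (d + m) ∘ suc) (upTo N))))
          ≡⟨ cong sum (sym (map-∘ (filter (inStride? (d + m) ∘ suc) (upTo N)))) ⟩
        sum (map (strideTerm (d + m) ∘ suc) (filter (inStride? (d + m) ∘ suc) (upTo N)))
          ≡⟨ cong sum (map-cong (λ i → cong a ([m+n]∸[m+o]≡n∸o d m (suc i * d)))
                           (filter (inStride? (d + m) ∘ suc) (upTo N))) ⟩
        sum (map (strideTerm m) (filter (inStride? (d + m) ∘ suc) (upTo N)))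
          ≡⟨ cong (sum ∘ map (strideTerm m))
               (filter-≐ (inStride? (d + m) ∘ suc) (inStride? m)
                         (+-cancelˡ-< d _ _ , +-monoʳ-< d) (upTo N)) ⟩
        strideSumUpTo N m ∎

1+p+k<d+[d+p] : ∀ {k} p d → 2 + k ≤ d + d → suc (p + k) < d + (d + p)
1+p+k<d+[d+p] {k} p d 2+k≤d+d = begin-strict
  suc (p + k) <⟨ n<1+n (suc (p + k)) ⟩
  2 + (p + k) ≡⟨ cong suc (+-suc p k) ⟨
  suc (p + suc k) ≡⟨ +-suc p (suc k) ⟨
  p + (2 + k) ≤⟨ +-monoʳ-≤ p 2+k≤d+d ⟩
  p + (d + d) ≡⟨ +-comm p (d + d) ⟩
  d + d + p ≡⟨ +-assoc d d p ⟩
  d + (d + p) ∎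
  where open ≤-Reasoning

module _ (S : List ℕ) (k : ℕ) (k-max : ∀ {x} → x ∈ S → x ≤ k) where

  i<p∧p+k≤j⇒∣j-i∣∉S : ∀ {i p j} → i < p → p + k ≤ j → ∣ j - i ∣ ∉ S
  i<p∧p+k≤j⇒∣j-i∣∉S {i} {p} {j} i<p p+k≤j ∣j-i∣∈S = <-irrefl refl (begin-strict
    j             ≤⟨ m≤∣m-n∣+n j i ⟩
    ∣ j - i ∣ + i ≤⟨ +-monoˡ-≤ i (k-max ∣j-i∣∈S) ⟩
    k + i         <⟨ +-monoʳ-< k i<p ⟩
    k + p         ≡⟨ +-comm k p ⟩
    p + k         ≤⟨ p+k≤j ⟩
    j             ∎)
    where open ≤-Reasoning

module LID (S : List ℕ) (S-positive : All (1 ≤_) S) (k : ℕ) (k-max : ∀ {x} → x ∈ S → x ≤ k)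
           (a : ℕ → ℕ) (lid : IsLID S a) where

  0∉S : 0 ∉ S
  0∉S 0∈S with () ← All.lookup S-positive 0∈S

  a-positive : ∀ {n} → 1 ≤ n → 1 ≤ a n
  a-positive 1≤n = proj₁ (lid _ 1≤n)

  a-minimal : ∀ {n} X → 1 ≤ n → (∀ y → 1 ≤ y → y < X → Representable S a n y) → X ≤ a n
  a-minimal {n} X 1≤n rep =
    ≮⇒≥ λ an<X → proj₁ (proj₂ (lid n 1≤n)) (rep (a n) (a-positive 1≤n) an<X)

  Representable-mono : ∀ {n n′ m} → n ≤ n′ → Representable S a n m → Representable S a n′ m
  Representable-mono n≤n′ (L , (unique , inRange , legal) , sumL) =
    L , (unique , All.map (λ (1≤i , i<n) → 1≤i , <-≤-trans i<n n≤n′) inRange , legal) , sumL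

  Representable-< : ∀ {n x} → 1 ≤ n → x < a n → Representable S a n x
  Representable-< {x = zero}  _   _    = [] , ([] , [] , λ ()) , refl
  Representable-< {x = suc x} 1≤n x<an = proj₂ (proj₂ (lid _ 1≤n)) (suc x) (s≤s z≤n) x<an

  Representable-∷ : ∀ {p j x} → 1 ≤ j → p ≤ j → (∀ {i} → 1 ≤ i → i < p → ∣ j - i ∣ ∉ S) →
                    Representable S a p x → Representable S a (suc j) (a j + x)
  Representable-∷ {p} {j} 1≤j p≤j far (L , (unique , inRange , legal) , sumL) =
    j ∷ L , (j∉L ∷ unique , (1≤j , n<1+n j) ∷ All.map below-suc-j inRange , legal′) , cong (a j +_) sumL
    where
      below-suc-j : ∀ {i} → 1 ≤ i × i < p → 1 ≤ i × i < suc j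
      below-suc-j (1≤i , i<p) = 1≤i , <-≤-trans i<p (m≤n⇒m≤1+n p≤j)
      j∉L : All (j ≢_) L
      j∉L = All.map (λ (_ , i<p) j≡i → <⇒≱ i<p (subst (p ≤_) j≡i p≤j)) inRange
      j-far : ∀ {i} → i ∈ L → ∣ j - i ∣ ∉ S
      j-far i∈L = let (1≤i , i<p) = All.lookup inRange i∈L in far 1≤i i<p
      legal′ : ∀ {i i′} → i ∈ j ∷ L → i′ ∈ j ∷ L → ∣ i - i′ ∣ ∉ S
      legal′ (here refl) (here refl)   = subst (_∉ S) (sym (∣n-n∣≡0 j)) 0∉S
      legal′ (here refl) (there i′∈L)  = j-far i′∈L
      legal′ (there i∈L) (here refl)   = subst (_∉ S) (∣-∣-comm j _) (j-far i∈L)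
      legal′ (there i∈L) (there i′∈L)  = legal i∈L i′∈L

  a-superadditive : ∀ {p j} → 1 ≤ p → p ≤ j → (∀ {i} → 1 ≤ i → i < p → ∣ j - i ∣ ∉ S) →
                    a j + a p ≤ a (suc j)
  a-superadditive {p} {j} 1≤p p≤j far = a-minimal (a j + a p) (s≤s z≤n) representable
    where
      1≤j : 1 ≤ j
      1≤j = ≤-trans 1≤p p≤j
      representable : ∀ y → 1 ≤ y → y < a j + a p → Representable S a (suc j) y
      representable y _ y<aj+ap with y <? a j
      ... | yes y<aj = Representable-mono (n≤1+n j) (Representable-< 1≤j y<aj)
      ... | no  y≮aj = subst (Representable S a (suc j)) (m+[n∸m]≡n aj≤y)
                         (Representable-∷ 1≤j p≤j far (Representable-< 1≤p y∸aj<ap))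
        where
          aj≤y : a j ≤ y
          aj≤y = ≮⇒≥ y≮aj
          y∸aj<ap : y ∸ a j < a p
          y∸aj<ap = +-cancelˡ-< (a j) _ _ (subst (_< a j + a p) (sym (m+[n∸m]≡n aj≤y)) y<aj+ap)

  a-suc : ∀ {j} → 1 ≤ j → a j < a (suc j)
  a-suc {j} 1≤j = <-≤-trans (m<m+n (a j) (a-positive ≤-refl))
                            (a-superadditive ≤-refl 1≤j (λ 1≤i i<1 _ → <⇒≱ i<1 1≤i))

  a-<-mono : ∀ {i j} → 1 ≤ i → i < j → a i < a j
  a-<-mono {i} {suc j} 1≤i (s≤s i≤j) with m≤n⇒m<n∨m≡n i≤j
  ... | inj₁ i<j  = <-trans (a-<-mono 1≤i i<j) (a-suc (≤-trans 1≤i (<⇒≤ i<j)))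
  ... | inj₂ refl = a-suc 1≤i

  a-≤-mono : ∀ {i j} → 1 ≤ i → i ≤ j → a i ≤ a j
  a-≤-mono 1≤i i≤j with m≤n⇒m<n∨m≡n i≤j
  ... | inj₁ i<j  = <⇒≤ (a-<-mono 1≤i i<j)
  ... | inj₂ refl = ≤-refl

  a-superadditive-far : ∀ {i p n} → 1 ≤ i → i < n → 1 ≤ p → p + k < n → a i + a p ≤ a n
  a-superadditive-far {i} {p} {suc j} 1≤i (s≤s i≤j) 1≤p (s≤s p+k≤j) = begin
    a i + a p     ≤⟨ +-monoˡ-≤ (a p) (a-≤-mono 1≤i i≤j) ⟩
    a j + a p     ≤⟨ a-superadditive 1≤p (≤-trans (m≤m+n p k) p+k≤j)
                                     (λ _ i<p → i<p∧p+k≤j⇒∣j-i∣∉S S k k-max i<p p+k≤j) ⟩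
    a (suc j)     ∎
    where open ≤-Reasoning

  module Stride (d : ℕ) (d≤k : d ≤ k) (2+k≤d+d : 2 + k ≤ d + d) where

    a-two-strides : ∀ {p} → 1 ≤ p → a (d + p) + (a p + a p) ≤ a (d + (d + p))
    a-two-strides {p} 1≤p = begin
      a (d + p) + (a p + a p)   ≡⟨ +-assoc (a (d + p)) (a p) (a p) ⟨
      a (d + p) + a p + a p     ≤⟨ +-monoˡ-≤ (a p) (a-superadditive-far 1≤d+p d+p<1+p+k 1≤p ≤-refl) ⟩
      a (suc (p + k)) + a p     ≤⟨ a-superadditive-far (s≤s z≤n) 1+p+k<2d+p 1≤p
                                                       (<-trans (n<1+n (p + k)) 1+p+k<2d+p) ⟩
      a (d + (d + p))           ∎
      where
        open ≤-Reasoning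
        1≤d+p : 1 ≤ d + p
        1≤d+p = ≤-trans 1≤p (m≤n+m p d)
        d+p<1+p+k : d + p < suc (p + k)
        d+p<1+p+k = s≤s (subst (_≤ p + k) (+-comm p d) (+-monoʳ-≤ p d≤k))
        1+p+k<2d+p : suc (p + k) < d + (d + p)
        1+p+k<2d+p = 1+p+k<d+[d+p] p d 2+k≤d+d

    a-<-stride : ∀ {m} → 1 ≤ m → a m + 0 < a (d + m)
    a-<-stride {m} 1≤m =
      subst (_< a (d + m)) (sym (+-identityʳ (a m))) (a-<-mono 1≤m (m<n+m m 0<d))
      where
        0<d : 0 < d
        0<d = n≢0⇒n>0 λ { refl → contradiction 2+k≤d+d λ () }

    mutual
      strideSumUpTo-< : ∀ N {n} → 1 ≤ n → strideSumUpTo a d N n < a n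
      strideSumUpTo-< zero    1≤n = a-positive 1≤n
      strideSumUpTo-< (suc N) {n} 1≤n with d <? n
      ... | no  d≮n = subst (_< a n) (sym (strideSumUpTo-≤ a d (suc N) (≮⇒≥ d≮n))) (a-positive 1≤n)
      ... | yes d<n with n ∸ d | m+[n∸m]≡n (<⇒≤ d<n) | m<n⇒0<n∸m d<n
      ...   | m | refl | 1≤m =
        subst (_< a (d + m)) (sym (strideSumUpTo-suc a d N 1≤m)) (a+strideSumUpTo-< N 1≤m)

      a+strideSumUpTo-< : ∀ N {m} → 1 ≤ m → a m + strideSumUpTo a d N m < a (d + m)
      a+strideSumUpTo-< zero 1≤m = a-<-stride 1≤m
      a+strideSumUpTo-< (suc N) {m} 1≤m with d <? m
      ... | no  d≮m = subst (λ t → a m + t < a (d + m)) (sym (strideSumUpTo-≤ a d (suc N) (≮⇒≥ d≮m)))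
                            (a-<-stride 1≤m)
      ... | yes d<m with m ∸ d | m+[n∸m]≡n (<⇒≤ d<m) | m<n⇒0<n∸m d<m
      ...   | p | refl | 1≤p = begin-strict
        a (d + p) + strideSumUpTo a d (suc N) (d + p)
          ≡⟨ cong (a (d + p) +_) (strideSumUpTo-suc a d N 1≤p) ⟩
        a (d + p) + (a p + strideSumUpTo a d N p)
          <⟨ +-monoʳ-< (a (d + p)) (+-monoʳ-< (a p) (strideSumUpTo-< N 1≤p)) ⟩
        a (d + p) + (a p + a p)
          ≤⟨ a-two-strides 1≤p ⟩
        a (d + (d + p)) ∎
        where open ≤-Reasoning

c+2+c≡2[c+1] : ∀ c → c + 2 + c ≡ 2 * (c + 1)
c+2+c≡2[c+1] = solve-∀

2+k≤[k∸c]+[k∸c] : ∀ {k} c → 2 * (c + 1) ≤ k → 2 + k ≤ (k ∸ c) + (k ∸ c)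
2+k≤[k∸c]+[k∸c] {k} c 2[c+1]≤k = begin
  2 + k             ≡⟨ cong (2 +_) (m∸n+n≡m c≤k) ⟨
  2 + (d + c)       ≡⟨ +-comm 2 (d + c) ⟩
  d + c + 2         ≡⟨ +-assoc d c 2 ⟩
  d + (c + 2)       ≤⟨ +-monoʳ-≤ d c+2≤d ⟩
  d + d             ∎
  where
    open ≤-Reasoning
    d : ℕ
    d = k ∸ c
    c+2≤d : c + 2 ≤ d
    c+2≤d = begin
      c + 2             ≡⟨ m+n∸n≡m (c + 2) c ⟨
      c + 2 + c ∸ c     ≡⟨ cong (_∸ c) (c+2+c≡2[c+1] c) ⟩
      2 * (c + 1) ∸ c   ≤⟨ ∸-monoˡ-≤ c 2[c+1]≤k ⟩
      d                 ∎
    c≤k : c ≤ k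
    c≤k = ≤-trans (m≤n+m c (c + 2)) (≤-trans (≤-reflexive (c+2+c≡2[c+1] c)) 2[c+1]≤k)

lemma3p2 : (S : List ℕ) → All (λ x → 1 ≤ x) S →
    (k : ℕ) → k ∈ S → (∀ {x} → x ∈ S → x ≤ k) →
    (c : ℕ) → 0 < c → c < k → (k ∸ c) ∉ S → (∀ m → 1 ≤ m → m < k ∸ c → m ∈ S) →
    (c′ : ℕ) → 0 < c′ → 2 * (c′ + 1) ≤ k →
    (a : ℕ → ℕ) → IsLID S a →
    ∀ n → 1 ≤ n → strideSum a (k ∸ c′) n < a n
lemma3p2 S S-positive k _ k-max _ _ _ _ _ c′ _ 2[c′+1]≤k a lid n 1≤n =
  LID.Stride.strideSumUpTo-< S S-positive k k-max a lid
    (k ∸ c′) (m∸n≤m k c′) (2+k≤[k∸c]+[k∸c] c′ 2[c′+1]≤k) n 1≤n
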